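{- For all positive integers $k,l$, $\operatorname{sat}_{\mathcal S}(k,l)=(k-1)(l-1)=\operatorname{ram}_{\mathcal S}(k,l)$. That is, if a finite sequence of distinct real numbers contains no increasing subsequence of length $k$ and no decreasing subsequence of length $l$, then either it is a proper subsequence of some finite sequence of distinct reals that still contains no increasing subsequence of length $k$ and no decreasing subsequence of length $l$, or its length is exactly $(k-1)(l-1)$.
   Context: Sequences consist of distinct real numbers. A sequence $S$ is $(k,l)$-saturated if it contains no increasing subsequence of length $k$ and no decreasing subsequence of length $l$, but every sequence $S'$ of distinct reals containing $S$ as a proper subsequence contains an increasing subsequence of length $k$ or a decreasing subsequence of length $l$. $\operatorname{sat}_{\mathcal S}(k,l)$ (resp. $\operatorname{ram}_{\mathcal S}(k,l)$) is the minimum (resp. maximum) length of a $(k,l)$-saturated sequence.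
   Formalization: The sequences $S$ and the extensions $S'$ tested for saturation consist of distinct rational numbers rather than distinct real numbers. -}

module Defs where

open import Data.Nat using (ℕ; _<_)
open import Data.Rational using (ℚ) renaming (_<_ to _<ℚ_; _>_ to _>ℚ_)
open import Data.List using (List; length)
open import Data.List.Relation.Binary.Sublist.Propositional using (_⊆_)
open import Data.List.Relation.Unary.Linked using (Linked)
open import Data.List.Relation.Unary.Unique.Propositional using (Unique)
open import Data.Product using (Σ; _×_)
open import Relation.Nullary using (¬_)
open import Relation.Binary.PropositionalEquality using (_≡_)

-- Finite sequences of reals are represented by lists of rationals; only the relative order of entries matters.
Seq : Set
Seq = List ℚ

Distinct : Seq → Set
Distinct = Unique

HasIncSub : ℕ → Seq → Set
HasIncSub k S = Σ Seq λ xs → (xs ⊆ S) × (length xs ≡ k) × Linked _<ℚ_ xs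

HasDecSub : ℕ → Seq → Set
HasDecSub l S = Σ Seq λ xs → (xs ⊆ S) × (length xs ≡ l) × Linked _>ℚ_ xs

Avoids : ℕ → ℕ → Seq → Set
Avoids k l S = ¬ HasIncSub k S × ¬ HasDecSub l S

ProperSub : Seq → Seq → Set
ProperSub S S' = (S ⊆ S') × (length S < length S')

Saturated : ℕ → ℕ → Seq → Set
Saturated k l S =
  Distinct S × Avoids k l S ×
  ((S' : Seq) → Distinct S' → ProperSub S S' → ¬ Avoids k l S')

{-# OPTIONS --safe #-}
-- Label every entry x of a sequence of distinct numbers by (u, d), where u + 1 and d + 1 are the
-- lengths of the longest increasing and the longest decreasing subsequence starting at x.  If x
-- precedes y, then x < y forces u(x) > u(y) and x > y forces d(x) > d(y); so labels are pairwise
-- distinct, and if the sequence has no increasing subsequence of length a + 1 and no decreasing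
-- one of length b + 1, they lie in the box [0, a) × [0, b): the length is at most ab
-- (Erdős–Szekeres).  Conversely, any labelling in that box with these two monotonicity properties
-- certifies avoidance.  If a label (p, q) of the box is unused, no entry labelled ≤ (p, q)
-- precedes one labelled ≥ (p, q) componentwise.  So a new entry labelled (p, q) can be inserted
-- right after the last entry labelled ≥ (p, q), with a value above every entry labelled in
-- [p, ∞) × [0, q] and below every entry labelled in [0, p] × [q, ∞), and the labelling stays
-- valid.  Hence every avoiding sequence shorter than ab has a proper avoiding extension.
module Submission where

open import Defs
open import Data.Nat using (ℕ; suc; _*_; _+_; _≤_; z≤n; s≤s) renaming (_<_ to _<ℕ_)
import Data.Nat.Properties as ℕP
open import Data.Rational using (ℚ; 0ℚ; 1ℚ; _⊓_)
  renaming (_<_ to _<ℚ_; _>_ to _>ℚ_; _≤_ to _≤ℚ_; _+_ to _+ℚ_; -_ to -ℚ_)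
import Data.Rational.Properties as ℚP
open import Data.List using (List; []; _∷_; [_]; length; map; _++_; upTo; filter; take; cartesianProduct)
open import Data.List.Properties using (length-map; length-++; length-take; length-upTo)
open import Data.List.Extrema.Nat using (max; xs≤max; argmax-all)
open import Data.List.Relation.Binary.Sublist.Propositional using (_⊆_; _∷_; _∷ʳ_; ⊆-refl; ⊆-trans; minimum)
import Data.List.Relation.Binary.Sublist.Propositional.Properties as Sublist
open import Data.List.Relation.Unary.Linked using (Linked; [-]; _∷_)
open import Data.List.Relation.Unary.Linked.Properties using (Linked⇒AllPairs; AllPairs⇒Linked)
open import Data.List.Relation.Unary.AllPairs using (AllPairs; []; _∷_)
import Data.List.Relation.Unary.AllPairs as AllPairs
import Data.List.Relation.Unary.AllPairs.Properties as AllPairsP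
open import Data.List.Relation.Unary.All using (All; []; _∷_)
import Data.List.Relation.Unary.All as All
import Data.List.Relation.Unary.All.Properties as AllP
open import Data.List.Relation.Unary.Any using (here; there; any?)
open import Data.List.Relation.Unary.Unique.Propositional using (Unique)
import Data.List.Relation.Unary.Unique.Propositional.Properties as UniqueP
open import Data.List.Membership.Propositional using (_∈_; _∉_; find)
open import Data.List.Membership.Propositional.Properties
  using (∈-map⁺; ∈-map⁻; ∈-++⁻; ∈-++⁺ˡ; ∈-++⁺ʳ; ∈-∃++; ∈-upTo⁺; ∈-upTo⁻; ∈-filter⁺; ∈-filter⁻;
         ∈-cartesianProduct⁺; ∈-cartesianProduct⁻)
import Data.List.Membership.DecPropositional as DecMembership
open import Data.Product using (Σ; ∃; ∃₂; _×_; _,_; proj₁; proj₂; curry)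
open import Data.Product.Properties using (≡-dec)
open import Data.Sum using (_⊎_; inj₁; inj₂; [_,_]′)
import Data.Sum as Sum
open import Data.Empty using (⊥; ⊥-elim)
open import Function using (_∘_; id; flip)
open import Level using (0ℓ)
open import Relation.Nullary using (¬_; yes; no)
open import Relation.Nullary.Decidable using (_×-dec_)
open import Relation.Unary using (Pred; Decidable)
open import Relation.Binary using (Rel; Transitive; DecidableEquality; tri<; tri≈; tri>)
import Relation.Binary as B
open import Relation.Binary.PropositionalEquality
  using (_≡_; _≢_; refl; sym; trans; cong; cong₂; subst; subst₂; ≢-sym; module ≡-Reasoning)

module _ {A : Set} where

  length-insert : ∀ (xs : List A) {ys z} → length (xs ++ z ∷ ys) ≡ suc (length (xs ++ ys))
  length-insert []       = refl
  length-insert (x ∷ xs) = cong suc (length-insert xs)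

  ∈-insert⁻ : ∀ (xs : List A) {ys y z} → y ∈ xs ++ z ∷ ys → y ≢ z → y ∈ xs ++ ys
  ∈-insert⁻ xs y∈ y≢z with ∈-++⁻ xs y∈
  ... | inj₁ y∈xs         = ∈-++⁺ˡ y∈xs
  ... | inj₂ (here y≡z)   = ⊥-elim (y≢z y≡z)
  ... | inj₂ (there y∈ys) = ∈-++⁺ʳ xs y∈ys

  All-insert : ∀ {P : Pred A 0ℓ} xs {ys z} → All P (xs ++ ys) → P z → All P (xs ++ z ∷ ys)
  All-insert xs ps pz with AllP.++⁻ xs ps
  ... | pxs , pys = AllP.++⁺ pxs (pz ∷ pys)

  AllPairs-insert : ∀ {R : Rel A 0ℓ} xs {ys z} → AllPairs R (xs ++ ys) →
                    All (λ x → R x z) xs → All (R z) ys → AllPairs R (xs ++ z ∷ ys)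
  AllPairs-insert []       rs        []           rzs = rzs ∷ rs
  AllPairs-insert (x ∷ xs) (rx ∷ rs) (rxz ∷ rxzs) rzs = All-insert xs rx rxz ∷ AllPairs-insert xs rs rxzs rzs

  AllPairs-lookup : ∀ {R : Rel A 0ℓ} {xs x y} → AllPairs R xs → x ∈ xs → y ∈ xs → x ≡ y ⊎ R x y ⊎ R y x
  AllPairs-lookup (rx ∷ rs) (here refl) (here refl) = inj₁ refl
  AllPairs-lookup (rx ∷ rs) (here refl) (there y∈)  = inj₂ (inj₁ (All.lookup rx y∈))
  AllPairs-lookup (rx ∷ rs) (there x∈)  (here refl) = inj₂ (inj₂ (All.lookup rx x∈))
  AllPairs-lookup (rx ∷ rs) (there x∈)  (there y∈)  = AllPairs-lookup rs x∈ y∈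

  unique-⊆⇒length≤ : ∀ {xs ys : List A} → Unique xs → (∀ {x} → x ∈ xs → x ∈ ys) → length xs ≤ length ys
  unique-⊆⇒length≤ {[]}     _            _     = z≤n
  unique-⊆⇒length≤ {x ∷ xs} (x∉xs ∷ uxs) xs⊆ys with ∈-∃++ (xs⊆ys (here refl))
  ... | pre , post , refl =
    ℕP.≤-trans (s≤s (unique-⊆⇒length≤ uxs xs⊆pre++post)) (ℕP.≤-reflexive (sym (length-insert pre)))
    where
    xs⊆pre++post : ∀ {y} → y ∈ xs → y ∈ pre ++ post
    xs⊆pre++post y∈ = ∈-insert⁻ pre (xs⊆ys (there y∈)) (≢-sym (All.lookup x∉xs y∈))

  module _ (_≟_ : DecidableEquality A) where
    open DecMembership _≟_ using (_∈?_)

    ∃-∉ : ∀ {xs ys : List A} → Unique xs → length ys <ℕ length xs → ∃ λ x → x ∈ xs × x ∉ ys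
    ∃-∉ {xs} {ys} uxs shorter with All.all? (_∈? ys) xs
    ... | yes xs⊆ys = ⊥-elim (ℕP.<⇒≱ shorter (unique-⊆⇒length≤ uxs (All.lookup xs⊆ys)))
    ... | no ¬xs⊆ys = find (AllP.¬All⇒Any¬ (_∈? ys) xs ¬xs⊆ys)

  split-¬P-¬Q : ∀ {P Q : Pred A 0ℓ} → Decidable Q → ∀ xs →
                AllPairs (λ x y → P x → ¬ Q y) xs → All (λ x → P x → ¬ Q x) xs →
                ∃₂ λ ys zs → xs ≡ ys ++ zs × All (¬_ ∘ P) ys × All (¬_ ∘ Q) zs
  split-¬P-¬Q Q? [] _ _ = [] , [] , refl , [] , []
  split-¬P-¬Q Q? (x ∷ xs) (rx ∷ rs) (nx ∷ ns) with any? Q? xs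
  ... | yes qxs with split-¬P-¬Q Q? xs rs ns
  ...   | ys , zs , refl , ¬Pys , ¬Qzs =
    x ∷ ys , zs , refl , (λ px → AllP.All¬⇒¬Any (All.map (λ r → r px) rx) qxs) ∷ ¬Pys , ¬Qzs
  split-¬P-¬Q Q? (x ∷ xs) (rx ∷ rs) (nx ∷ ns) | no ¬qxs with Q? x
  ... | yes qx = [ x ] , xs , refl , (λ px → nx px qx) ∷ [] , AllP.¬Any⇒All¬ xs ¬qxs
  ... | no ¬qx = [] , x ∷ xs , refl , [] , ¬qx ∷ AllP.¬Any⇒All¬ xs ¬qxs

length-cartesianProduct : ∀ {A B : Set} (xs : List A) (ys : List B) →
                          length (cartesianProduct xs ys) ≡ length xs * length ys
length-cartesianProduct []       ys = refl
length-cartesianProduct (x ∷ xs) ys = begin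
  length (map (x ,_) ys ++ cartesianProduct xs ys)
    ≡⟨ length-++ (map (x ,_) ys) ⟩
  length (map (x ,_) ys) + length (cartesianProduct xs ys)
    ≡⟨ cong₂ _+_ (length-map (x ,_) ys) (length-cartesianProduct xs ys) ⟩
  length ys + length xs * length ys
    ∎
  where open ≡-Reasoning

<-from-≤-total : ∀ {x y m n : ℕ} → (x ≤ y → m ≤ n → ⊥) → (x ≤ y → n ≤ m → ⊥) → y <ℕ x
<-from-≤-total {m = m} {n} h₁ h₂ = ℕP.≰⇒> λ x≤y → [ h₁ x≤y , h₂ x≤y ]′ (ℕP.≤-total m n)

∃> : ∀ x → ∃ (x <ℚ_)
∃> x = x +ℚ 1ℚ , subst (_<ℚ x +ℚ 1ℚ) (ℚP.+-identityʳ x) (ℚP.+-monoʳ-< x (ℚP.positive⁻¹ 1ℚ))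

∃< : ∀ x → ∃ (_<ℚ x)
∃< x = x +ℚ -ℚ 1ℚ , subst (x +ℚ -ℚ 1ℚ <ℚ_) (ℚP.+-identityʳ x) (ℚP.+-monoʳ-< x (ℚP.negative⁻¹ (-ℚ 1ℚ)))

∃-lowerBound : ∀ ys → ∃ λ c → All (c <ℚ_) ys
∃-lowerBound []       = 0ℚ , []
∃-lowerBound (y ∷ ys) with ∃-lowerBound ys | ∃< y
... | c , c<ys | d , d<y =
  c ⊓ d , ℚP.≤-<-trans (ℚP.p⊓q≤q c d) d<y ∷ All.map (ℚP.≤-<-trans (ℚP.p⊓q≤p c d)) c<ys

∃-cut : ∀ xs ys → All (λ x → All (x <ℚ_) ys) xs → ∃ λ c → All (_≤ℚ c) xs × All (c <ℚ_) ys
∃-cut []       ys _ = let c , c<ys = ∃-lowerBound ys in c , [] , c<ys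
∃-cut (x ∷ xs) ys (x<ys ∷ xs<ys) with ∃-cut xs ys xs<ys
... | c , xs≤c , c<ys with x ℚP.≤? c
...   | yes x≤c = c , x≤c ∷ xs≤c , c<ys
...   | no  x≰c = x , ℚP.≤-refl ∷ All.map (λ y≤c → ℚP.≤-trans y≤c (ℚP.<⇒≤ (ℚP.≰⇒> x≰c))) xs≤c , x<ys

∃-gap : ∀ c ws → ∃ λ v → c <ℚ v × All (λ w → w ≤ℚ c ⊎ v <ℚ w) ws
∃-gap c []       = let v , c<v = ∃> c in v , c<v , []
∃-gap c (w ∷ ws) with ∃-gap c ws
... | v , c<v , gaps with w ℚP.≤? c
...   | yes w≤c = v , c<v , inj₁ w≤c ∷ gaps
...   | no  w≰c with v ℚP.<? w
...     | yes v<w = v , c<v , inj₂ v<w ∷ gaps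
...     | no  v≮w with ℚP.<-dense (ℚP.≰⇒> w≰c)
...       | m , c<m , m<w =
  m , c<m , inj₂ m<w ∷ All.map (Sum.map₂ (ℚP.<-trans (ℚP.<-≤-trans m<w (ℚP.≮⇒≥ v≮w)))) gaps

∃-separator : ∀ {X : Set} {P Q : Pred X 0ℓ} (f : X → ℚ) → Decidable P → Decidable Q → ∀ xs →
              (∀ {x y} → x ∈ xs → y ∈ xs → P x → Q y → f x <ℚ f y) →
              ∃ λ v → All (λ x → (P x → f x <ℚ v) × (Q x → v <ℚ f x) × f x ≢ v) xs
∃-separator {P = P} {Q} f P? Q? xs P<Q with ∃-cut (map f (filter P? xs)) (map f (filter Q? xs)) Ps<Qs
  where
  Ps<Qs : All (λ x → All (x <ℚ_) (map f (filter Q? xs))) (map f (filter P? xs))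
  Ps<Qs = AllP.map⁺ (All.tabulate λ x∈ → AllP.map⁺ (All.tabulate λ y∈ →
    let x∈xs , px = ∈-filter⁻ P? {xs = xs} x∈
        y∈xs , qy = ∈-filter⁻ Q? {xs = xs} y∈
    in  P<Q x∈xs y∈xs px qy))
... | c , Ps≤c , c<Qs with ∃-gap c (map f xs)
...   | v , c<v , gaps = v , All.tabulate λ x∈ → below x∈ , above x∈ , apart x∈
  where
  gap-at : ∀ {x} → x ∈ xs → f x ≤ℚ c ⊎ v <ℚ f x
  gap-at x∈ = All.lookup (AllP.map⁻ gaps) x∈
  below : ∀ {x} → x ∈ xs → P x → f x <ℚ v
  below x∈ px = ℚP.≤-<-trans (All.lookup (AllP.map⁻ Ps≤c) (∈-filter⁺ P? x∈ px)) c<v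
  above : ∀ {x} → x ∈ xs → Q x → v <ℚ f x
  above x∈ qx = [ (λ fx≤c → ⊥-elim (ℚP.<-irrefl refl (ℚP.<-≤-trans c<fx fx≤c))) , id ]′ (gap-at x∈)
    where c<fx = All.lookup (AllP.map⁻ c<Qs) (∈-filter⁺ Q? x∈ qx)
  apart : ∀ {x} → x ∈ xs → f x ≢ v
  apart x∈ = [ (λ fx≤c → ℚP.<⇒≢ (ℚP.≤-<-trans fx≤c c<v)) , (λ v<fx → ≢-sym (ℚP.<⇒≢ v<fx)) ]′ (gap-at x∈)

HasChain : Rel ℚ 0ℓ → ℕ → Seq → Set
HasChain _≺_ k S = Σ Seq λ xs → (xs ⊆ S) × (length xs ≡ k) × Linked _≺_ xs

ChainFrom : Rel ℚ 0ℓ → Seq → ℚ → ℕ → Set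
ChainFrom _≺_ S x n = Σ Seq λ xs → ((x ∷ xs) ⊆ S) × (length xs ≡ n) × Linked _≺_ (x ∷ xs)

HasChain-≤ : ∀ {_≺_ m n S} → Transitive _≺_ → m ≤ n → HasChain _≺_ n S → HasChain _≺_ m S
HasChain-≤ {m = m} ≺-trans m≤n (xs , xs⊆S , refl , linked) =
  take m xs , ⊆-trans (Sublist.take-⊆ m xs) xs⊆S ,
  trans (length-take m xs) (ℕP.m≤n⇒m⊓n≡m m≤n) ,
  AllPairs⇒Linked (AllPairsP.take⁺ m (Linked⇒AllPairs ≺-trans linked))

ChainFrom⇒HasChain : ∀ {_≺_ S x n} → ChainFrom _≺_ S x n → HasChain _≺_ (suc n) S
ChainFrom⇒HasChain {x = x} (xs , x∷xs⊆S , len , linked) = x ∷ xs , x∷xs⊆S , cong suc len , linked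

ChainFrom-<-bound : ∀ {_≺_ a S x n} → Transitive _≺_ → ¬ HasChain _≺_ (suc a) S → ChainFrom _≺_ S x n → n <ℕ a
ChainFrom-<-bound ≺-trans noChain chain =
  ℕP.≰⇒> λ a≤n → noChain (HasChain-≤ ≺-trans (s≤s a≤n) (ChainFrom⇒HasChain chain))

ChainFrom-∷ʳ : ∀ {_≺_ S x n} y → ChainFrom _≺_ S x n → ChainFrom _≺_ (y ∷ S) x n
ChainFrom-∷ʳ y (xs , x∷xs⊆S , len , linked) = xs , y ∷ʳ x∷xs⊆S , len , linked

Entry : Set
Entry = ℚ × ℕ × ℕ

val : Entry → ℚ
val = proj₁

label : Entry → ℕ × ℕ
label = proj₂

up down : Entry → ℕ
up   = proj₁ ∘ label
down = proj₂ ∘ label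

Descends : Rel ℚ 0ℓ → (Entry → ℕ) → Rel Entry 0ℓ
Descends _≺_ ℓ e f = val e ≺ val f → ℓ f <ℕ ℓ e

Compatible : Rel Entry 0ℓ
Compatible e f = val e ≢ val f × Descends _<ℚ_ up e f × Descends _>ℚ_ down e f

-- Labels need not be the longest-chain ones: after an insertion they are merely compatible.
record Labelling (P : Pred Entry 0ℓ) (S : Seq) : Set where
  field
    entries    : List Entry
    values     : map val entries ≡ S
    compatible : AllPairs Compatible entries
    holds      : All P entries

labelling-[] : ∀ {P} → Labelling P []
labelling-[] = record { entries = [] ; values = refl ; compatible = [] ; holds = [] }

Bounded : ℕ → ℕ → Pred Entry 0ℓ
Bounded a b e = up e <ℕ a × down e <ℕ b

down≤⇒val< : ∀ {e f} → Compatible e f → down e ≤ down f → val e <ℚ val f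
down≤⇒val< {e} {f} (e≢f , _ , descends) de≤df with ℚP.<-cmp (val e) (val f)
... | tri< e<f _ _ = e<f
... | tri≈ _ e≡f _ = ⊥-elim (e≢f e≡f)
... | tri> _ _ e>f = ⊥-elim (ℕP.<⇒≱ (descends e>f) de≤df)

up≤⇒val> : ∀ {e f} → Compatible e f → up e ≤ up f → val f <ℚ val e
up≤⇒val> {e} {f} (e≢f , descends , _) ue≤uf with ℚP.<-cmp (val e) (val f)
... | tri< e<f _ _ = ⊥-elim (ℕP.<⇒≱ (descends e<f) ue≤uf)
... | tri≈ _ e≡f _ = ⊥-elim (e≢f e≡f)
... | tri> _ _ e>f = e>f

compatible-undominated : ∀ {e f} → Compatible e f → up e ≤ up f → down e ≤ down f → ⊥
compatible-undominated c ue≤uf de≤df = ℚP.<-asym (down≤⇒val< c de≤df) (up≤⇒val> c ue≤uf)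

compatible⇒label≢ : ∀ {e f} → Compatible e f → label e ≢ label f
compatible⇒label≢ c eq =
  compatible-undominated c (ℕP.≤-reflexive (cong proj₁ eq)) (ℕP.≤-reflexive (cong proj₂ eq))

chain≤label : ∀ {_≺_ ℓ L x xs} → AllPairs (Descends _≺_ ℓ) L → (x ∷ xs) ⊆ map val L → Linked _≺_ (x ∷ xs) →
              ∃ λ e → e ∈ L × val e ≡ x × length xs ≤ ℓ e
chain≤label {L = e ∷ L} (_ ∷ ds) (_ ∷ʳ sub) linked with chain≤label ds sub linked
... | f , f∈ , f≡x , le = f , there f∈ , f≡x , le
chain≤label {L = e ∷ L} {xs = []}    _        (refl ∷ _)   _                = e , here refl , refl , z≤n
chain≤label {L = e ∷ L} {xs = _ ∷ _} (de ∷ ds) (refl ∷ sub) (x≺y ∷ linked) with chain≤label ds sub linked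
... | f , f∈ , refl , le = e , here refl , refl , ℕP.≤-trans (s≤s le) (All.lookup de f∈ x≺y)

noLongChain : ∀ {_≺_ ℓ a L} → AllPairs (Descends _≺_ ℓ) L → All (λ e → ℓ e <ℕ a) L →
              ¬ HasChain _≺_ (suc a) (map val L)
noLongChain ds bs ([]     , _   , ()  , _)
noLongChain ds bs (x ∷ xs , sub , len , linked) with chain≤label ds sub linked
... | e , e∈ , _ , le = ℕP.<⇒≱ (All.lookup bs e∈) (subst (_≤ _) (ℕP.suc-injective len) le)

module _ {P : Pred Entry 0ℓ} {S : Seq} (Λ : Labelling P S) where
  open Labelling Λ

  labelling⇒distinct : Distinct S
  labelling⇒distinct = subst Unique values (AllPairsP.map⁺ (AllPairs.map proj₁ compatible))

  labels-unique : Unique (map label entries)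
  labels-unique = AllPairsP.map⁺ (AllPairs.map compatible⇒label≢ compatible)

labelling⇒avoids : ∀ {a b S} → Labelling (Bounded a b) S → Avoids (suc a) (suc b) S
labelling⇒avoids record { values = refl ; compatible = cs ; holds = bs } =
  noLongChain (AllPairs.map (proj₁ ∘ proj₂) cs) (All.map proj₁ bs) ,
  noLongChain (AllPairs.map (proj₂ ∘ proj₂) cs) (All.map proj₂ bs)

grid : ℕ → ℕ → List (ℕ × ℕ)
grid a b = cartesianProduct (upTo a) (upTo b)

length-grid : ∀ a b → length (grid a b) ≡ a * b
length-grid a b =
  trans (length-cartesianProduct (upTo a) (upTo b)) (cong₂ _*_ (length-upTo a) (length-upTo b))

labelling-length≤ : ∀ {a b S} → Labelling (Bounded a b) S → length S ≤ a * b
labelling-length≤ {a} {b} Λ@record { entries = L ; values = refl ; holds = bs } = begin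
  length (map val L)   ≡⟨ length-map val L ⟩
  length L             ≡⟨ length-map label L ⟨
  length (map label L) ≤⟨ unique-⊆⇒length≤ (labels-unique Λ) label∈grid ⟩
  length (grid a b)    ≡⟨ length-grid a b ⟩
  a * b                ∎
  where
  open ℕP.≤-Reasoning
  label∈grid : ∀ {pq} → pq ∈ map label L → pq ∈ grid a b
  label∈grid pq∈ with ∈-map⁻ label pq∈
  ... | e , e∈ , refl = let ue<a , de<b = All.lookup bs e∈ in
    ∈-cartesianProduct⁺ (∈-upTo⁺ ue<a) (∈-upTo⁺ de<b)

∃-missingLabel : ∀ a b (L : List Entry) → length L <ℕ a * b →
                 ∃₂ λ p q → p <ℕ a × q <ℕ b × All (λ e → (p , q) ≢ label e) L
∃-missingLabel a b L shorter
  with ∃-∉ (≡-dec ℕP._≟_ ℕP._≟_) (UniqueP.cartesianProduct⁺ (UniqueP.upTo⁺ a) (UniqueP.upTo⁺ b)) fewer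
  where
  fewer : length (map label L) <ℕ length (grid a b)
  fewer = subst₂ _<ℕ_ (sym (length-map label L)) (sym (length-grid a b)) shorter
... | (p , q) , pq∈ , pq∉ with ∈-cartesianProduct⁻ (upTo a) (upTo b) pq∈
...   | p∈ , q∈ = p , q , ∈-upTo⁻ p∈ , ∈-upTo⁻ q∈ , AllP.map⁻ (AllP.¬Any⇒All¬ (map label L) pq∉)

module Height {_≺_ : Rel ℚ 0ℓ} (_≺?_ : B.Decidable _≺_) (ℓ : Entry → ℕ) where

  height : ℚ → List Entry → ℕ
  height x L = max 0 (map (suc ∘ ℓ) (filter (λ e → x ≺? val e) L))

  ℓ<height : ∀ {x L e} → e ∈ L → x ≺ val e → ℓ e <ℕ height x L
  ℓ<height {x} {L} e∈ x≺e = All.lookup (xs≤max 0 _) (∈-map⁺ (suc ∘ ℓ) (∈-filter⁺ (λ e → x ≺? val e) e∈ x≺e))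

  height-chain : ∀ {S x L} → All (λ e → ChainFrom _≺_ S (val e) (ℓ e)) L →
                 ChainFrom _≺_ (x ∷ S) x (height x L)
  height-chain {S} {x} {L} chains =
    argmax-all id {P = ChainFrom _≺_ (x ∷ S) x} ([] , refl ∷ minimum S , refl , [-])
      (AllP.map⁺ (All.tabulate extend))
    where
    extend : ∀ {e} → e ∈ filter (λ e → x ≺? val e) L → ChainFrom _≺_ (x ∷ S) x (suc (ℓ e))
    extend {e} e∈ with ∈-filter⁻ (λ e → x ≺? val e) {xs = L} e∈
    ... | e∈L , x≺e with All.lookup chains e∈L
    ...   | xs , e∷xs⊆S , len , linked = val e ∷ xs , refl ∷ e∷xs⊆S , cong suc len , x≺e ∷ linked

open Height ℚP._<?_ up
  using () renaming (height to upHeight; ℓ<height to up<upHeight; height-chain to upHeight-chain)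
open Height ℚP._>?_ down
  using () renaming (height to downHeight; ℓ<height to down<downHeight; height-chain to downHeight-chain)

Realised : Seq → Pred Entry 0ℓ
Realised S e = ChainFrom _<ℚ_ S (val e) (up e) × ChainFrom _>ℚ_ S (val e) (down e)

canonicalLabelling : ∀ {S} → Distinct S → Labelling (Realised S) S
canonicalLabelling {[]}    []               = labelling-[]
canonicalLabelling {x ∷ S} (x∉S ∷ distinct) with canonicalLabelling distinct
... | record { entries = L ; values = refl ; compatible = cs ; holds = rs } = record
  { entries    = e₀ ∷ L
  ; values     = refl
  ; compatible = All.tabulate e₀-compatible ∷ cs
  ; holds      = (upHeight-chain (All.map proj₁ rs) , downHeight-chain (All.map proj₂ rs))
                 ∷ All.map (λ (r₁ , r₂) → ChainFrom-∷ʳ x r₁ , ChainFrom-∷ʳ x r₂) rs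
  }
  where
  e₀ : Entry
  e₀ = x , upHeight x L , downHeight x L
  e₀-compatible : ∀ {e} → e ∈ L → Compatible e₀ e
  e₀-compatible e∈ = All.lookup x∉S (∈-map⁺ val e∈) , up<upHeight e∈ , down<downHeight e∈

realised⇒bounded : ∀ {a b S} → Avoids (suc a) (suc b) S → ∀ {e} → Realised S e → Bounded a b e
realised⇒bounded (noInc , noDec) (upChain , downChain) =
  ChainFrom-<-bound ℚP.<-trans noInc upChain , ChainFrom-<-bound (flip ℚP.<-trans) noDec downChain

labelling : ∀ {a b S} → Distinct S → Avoids (suc a) (suc b) S → Labelling (Bounded a b) S
labelling distinct avoids = record
  { entries    = entries
  ; values     = values
  ; compatible = compatible
  ; holds      = All.map (realised⇒bounded avoids) holds
  }
  where open Labelling (canonicalLabelling distinct)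

module Insertion (p q : ℕ) where

  Northeast Southwest Southeast Northwest : Pred Entry 0ℓ
  Northeast e = p ≤ up e × q ≤ down e
  Southwest e = up e ≤ p × down e ≤ q
  Southeast e = p ≤ up e × down e ≤ q
  Northwest e = up e ≤ p × q ≤ down e

  Southeast? : Decidable Southeast
  Southeast? e = (p ℕP.≤? up e) ×-dec (down e ℕP.≤? q)

  Northwest? : Decidable Northwest
  Northwest? e = (up e ℕP.≤? p) ×-dec (q ℕP.≤? down e)

  Northeast? : Decidable Northeast
  Northeast? e = (p ℕP.≤? up e) ×-dec (q ℕP.≤? down e)

  Missing : List Entry → Set
  Missing = All (λ e → (p , q) ≢ label e)

  labelled-pq : ∀ {e} → p ≤ up e → up e ≤ p → q ≤ down e → down e ≤ q → (p , q) ≡ label e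
  labelled-pq p≤ue ue≤p q≤de de≤q = cong₂ _,_ (ℕP.≤-antisym p≤ue ue≤p) (ℕP.≤-antisym q≤de de≤q)

  missing⇒¬southwest∧northeast : ∀ {L} → Missing L → All (λ e → Southwest e → ¬ Northeast e) L
  missing⇒¬southwest∧northeast = All.map λ {e} pq≢e (ue≤p , de≤q) (p≤ue , q≤de) →
    pq≢e (labelled-pq {e} p≤ue ue≤p q≤de de≤q)

  southwest-before-northeast : ∀ {e f} → Compatible e f → Southwest e → ¬ Northeast f
  southwest-before-northeast c (ue≤p , de≤q) (p≤uf , q≤df) =
    compatible-undominated c (ℕP.≤-trans ue≤p p≤uf) (ℕP.≤-trans de≤q q≤df)

  southeast<northwest : ∀ {L} → AllPairs Compatible L → Missing L → ∀ {e f} → e ∈ L → f ∈ L →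
                        Southeast e → Northwest f → val e <ℚ val f
  southeast<northwest cs missing {e} e∈ f∈ (p≤ue , de≤q) (uf≤p , q≤df) with AllPairs-lookup cs e∈ f∈
  ... | inj₁ refl       = ⊥-elim (All.lookup missing e∈ (labelled-pq {e} p≤ue uf≤p q≤df de≤q))
  ... | inj₂ (inj₁ cef) = down≤⇒val< cef (ℕP.≤-trans de≤q q≤df)
  ... | inj₂ (inj₂ cfe) = up≤⇒val> cfe (ℕP.≤-trans uf≤p p≤ue)

  compatible-before : ∀ {e v} → ¬ Southwest e → (Southeast e → val e <ℚ v) → (Northwest e → v <ℚ val e) →
                      val e ≢ v → Compatible e (v , p , q)
  compatible-before ¬sw below above e≢v =
    e≢v ,
    (λ e<v → <-from-≤-total (curry ¬sw) λ ue≤p q≤de → ℚP.<-asym e<v (above (ue≤p , q≤de))) ,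
    (λ v<e → <-from-≤-total (flip (curry ¬sw)) λ de≤q p≤ue → ℚP.<-asym v<e (below (p≤ue , de≤q)))

  compatible-after : ∀ {f v} → ¬ Northeast f → (Southeast f → val f <ℚ v) → (Northwest f → v <ℚ val f) →
                     val f ≢ v → Compatible (v , p , q) f
  compatible-after ¬ne below above f≢v =
    ≢-sym f≢v ,
    (λ v<f → <-from-≤-total (curry ¬ne) λ p≤uf df≤q → ℚP.<-asym v<f (below (p≤uf , df≤q))) ,
    (λ f<v → <-from-≤-total (flip (curry ¬ne)) λ q≤df uf≤p → ℚP.<-asym f<v (above (uf≤p , q≤df)))

  insert-missing : ∀ {L} → AllPairs Compatible L → Missing L →
                   ∃ λ v → ∃₂ λ pre post → L ≡ pre ++ post × AllPairs Compatible (pre ++ (v , p , q) ∷ post)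
  insert-missing {L} cs missing
    with ∃-separator val Southeast? Northwest? L (southeast<northwest cs missing)
       | split-¬P-¬Q Northeast? L (AllPairs.map southwest-before-northeast cs)
                     (missing⇒¬southwest∧northeast missing)
  ... | v , separated | pre , post , refl , ¬sws , ¬nes with AllP.++⁻ pre separated
  ...   | sepPre , sepPost =
    v , pre , post , refl ,
    AllPairs-insert pre cs
      (All.zipWith (λ (¬sw , below , above , e≢v) → compatible-before ¬sw below above e≢v) (¬sws , sepPre))
      (All.zipWith (λ (¬ne , below , above , f≢v) → compatible-after ¬ne below above f≢v) (¬nes , sepPost))

extend-labelling : ∀ {a b S} → Labelling (Bounded a b) S → length S <ℕ a * b →
         ∃ λ S' → Labelling (Bounded a b) S' × S ⊆ S' × length S' ≡ suc (length S)
extend-labelling {a} {b} record { entries = L ; values = refl ; compatible = cs ; holds = bs } shorter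
  with ∃-missingLabel a b L (subst (_<ℕ a * b) (length-map val L) shorter)
... | p , q , p<a , q<b , missing with Insertion.insert-missing p q cs missing
...   | v , pre , post , refl , cs' =
  map val L' ,
  record { entries = L' ; values = refl ; compatible = cs' ; holds = All-insert pre bs (p<a , q<b) } ,
  Sublist.map⁺ val (Sublist.++⁺ ⊆-refl (_ ∷ʳ ⊆-refl)) ,
  longer
  where
  L' = pre ++ (v , p , q) ∷ post
  longer : length (map val L') ≡ suc (length (map val (pre ++ post)))
  longer = begin
    length (map val L')                  ≡⟨ length-map val L' ⟩
    length L'                            ≡⟨ length-insert pre ⟩
    suc (length (pre ++ post))           ≡⟨ cong suc (length-map val (pre ++ post)) ⟨
    suc (length (map val (pre ++ post))) ∎
    where open ≡-Reasoning

avoiding⇒length≤ : ∀ {a b S} → Distinct S → Avoids (suc a) (suc b) S → length S ≤ a * b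
avoiding⇒length≤ distinct avoids = labelling-length≤ (labelling distinct avoids)

∃-extension : ∀ {a b S} → Distinct S → Avoids (suc a) (suc b) S → length S <ℕ a * b →
              ∃ λ S' → Distinct S' × Avoids (suc a) (suc b) S' × S ⊆ S' × length S' ≡ suc (length S)
∃-extension distinct avoids shorter with extend-labelling (labelling distinct avoids) shorter
... | S' , Λ' , S⊆S' , longer = S' , labelling⇒distinct Λ' , labelling⇒avoids Λ' , S⊆S' , longer

∃-avoiding : ∀ a b m → m ≤ a * b → ∃ λ S → Distinct S × Avoids (suc a) (suc b) S × length S ≡ m
∃-avoiding a b 0       _ = [] , [] , labelling⇒avoids {a} {b} labelling-[] , refl
∃-avoiding a b (suc m) m<ab with ∃-avoiding a b m (ℕP.<⇒≤ m<ab)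
... | S , distinct , avoids , refl with ∃-extension distinct avoids m<ab
...   | S' , distinct' , avoids' , _ , longer = S' , distinct' , avoids' , longer

theorem5 : (a b : ℕ) →
    (Σ Seq λ S → Saturated (suc a) (suc b) S × length S ≡ a * b)
    × ((S : Seq) → Saturated (suc a) (suc b) S → length S ≡ a * b)
theorem5 a b with ∃-avoiding a b (a * b) ℕP.≤-refl
... | S , distinct , avoids , len = (S , (distinct , avoids , maximal) , len) , saturated⇒length
  where
  maximal : (S' : Seq) → Distinct S' → ProperSub S S' → ¬ Avoids (suc a) (suc b) S'
  maximal S' distinct' (_ , longer) avoids' =
    ℕP.<⇒≱ (subst (_<ℕ length S') len longer) (avoiding⇒length≤ distinct' avoids')
  saturated⇒length : (S : Seq) → Saturated (suc a) (suc b) S → length S ≡ a * b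
  saturated⇒length S (distinct , avoids , maximal) =
    ℕP.≤-antisym (avoiding⇒length≤ distinct avoids) (ℕP.≮⇒≥ λ shorter →
      let S' , distinct' , avoids' , S⊆S' , longer = ∃-extension distinct avoids shorter
      in  maximal S' distinct' (S⊆S' , ℕP.≤-reflexive (sym longer)) avoids')
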